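{- Let $M=(X,rk)$ be a matroid of rank $r=rk(X)$. Then for every integer $i>r-d_2(M)$, \[ [x^i]\,T_M(x,1)=\binom{|X|-i-1}{r-i}-\sum_{\substack{C\in\mathcal{C}(M)\\ |C|<d_2(M)}}\binom{|X|-|C|-i-1}{|X|-r-1}. \]
   Context: For a matroid $M=(X,rk)$ with $r=rk(X)$, the Tutte polynomial is $T_M(x,y)=\sum_{A\subseteq X}(x-1)^{r-rk(A)}(y-1)^{|A|-rk(A)}$, and $[x^i]f(x)$ denotes the coefficient of $x^i$. A circuit is a set $C\subseteq X$ with $rk(C\setminus\{e\})=|C|-1=rk(C)$ for all $e\in C$; $\mathcal{C}(M)$ is the set of circuits of $M$. Let $\mathcal{D}(M)=\{A\subseteq X: rk(A\setminus\{e\})=rk(A)\text{ for every } e\in A\}$, and for $k\ge1$ let $d_k(M)=\min\{|A|: A\in\mathcal{D}(M),\ rk(A)=|A|-k\}$. -}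

module Defs where

open import Data.Nat as ℕ using (ℕ; zero; suc; _≤_; _∸_)
open import Data.Integer as ℤ using (ℤ; +_; -[1+_])
open import Data.Bool using (Bool; true; false)
open import Data.List using (List; []; _∷_; map; foldr; filter; _++_)
open import Data.Vec using (Vec; []; _∷_)
import Data.Vec
open import Data.Fin using (Fin)
open import Data.Fin.Subset using (Subset; ∣_∣; _∈_; _⊆_; _∪_; _∩_; _-_)
open import Data.Product using (Σ; _×_; _,_)
open import Data.Nat.Combinatorics using (_C_)
open import Relation.Binary.PropositionalEquality using (_≡_)
open import Relation.Nullary using (¬_; Dec)
open import Relation.Nullary.Decidable.Core using (_×-dec_; _→-dec_)
open import Data.Fin.Properties using (all?)
open import Data.Fin.Subset.Properties using (_∈?_)

record Matroid (n : ℕ) : Set where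
  field
    rk        : Subset n → ℕ
    rk-bound  : ∀ A → rk A ≤ ∣ A ∣
    rk-mono   : ∀ {A B} → A ⊆ B → rk A ≤ rk B
    rk-submod : ∀ A B → rk (A ∪ B) ℕ.+ rk (A ∩ B) ≤ rk A ℕ.+ rk B

module _ {n : ℕ} (M : Matroid n) where
  open Matroid M

  fullSet : Subset n
  fullSet = Data.Vec.replicate n true

  rank : ℕ
  rank = rk fullSet

  -- circuits: rk(C \ {e}) = |C| - 1 = rk(C) for all e ∈ C
  -- (written additively: "x = |C| - 1" as "x + 1 = |C|", so ∅ is not a circuit)
  IsCircuit : Subset n → Set
  IsCircuit C = (rk C ℕ.+ 1 ≡ ∣ C ∣)
              × (∀ e → e ∈ C → rk (C - e) ℕ.+ 1 ≡ ∣ C ∣)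

  InD : Subset n → Set
  InD A = ∀ e → e ∈ A → rk (A - e) ≡ rk A

  -- "d is d_k(M)": d is the minimum of |A| over A ∈ 𝒟(M) with rk(A) = |A| - k
  -- (rk A = |A| - k written as rk A + k = |A|, as |A| - k is an integer)
  IsDk : ℕ → ℕ → Set
  IsDk k d = (Σ (Subset n) λ A → InD A × (rk A ℕ.+ k ≡ ∣ A ∣) × (∣ A ∣ ≡ d))
           × (∀ A → InD A → rk A ℕ.+ k ≡ ∣ A ∣ → d ≤ ∣ A ∣)

allSubsets : (n : ℕ) → List (Subset n)
allSubsets zero    = [] ∷ []
allSubsets (suc n) = map (false ∷_) (allSubsets n) ++ map (true ∷_) (allSubsets n)

sumℤ : List ℤ → ℤ
sumℤ = foldr ℤ._+_ (+ 0)

-- Polynomials as coefficient lists (lowest degree first), over a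
-- coefficient type with 0, + and *.

module Poly {A : Set} (0# : A) (_+_ _*_ : A → A → A) where

  P : Set
  P = List A

  add : P → P → P
  add []       q        = q
  add p        []       = p
  add (a ∷ p)  (b ∷ q)  = (a + b) ∷ add p q

  scale : A → P → P
  scale a = map (a *_)

  mul : P → P → P
  mul []      q = []
  mul (a ∷ p) q = add (scale a q) (0# ∷ mul p q)

  pow : P → A → ℕ → P
  pow p 1# zero    = 1# ∷ []
  pow p 1# (suc k) = mul p (pow p 1# k)

  evalAt1 : P → A
  evalAt1 = foldr _+_ 0#

  coeff : ℕ → P → A
  coeff k       []      = 0#
  coeff zero    (a ∷ p) = a
  coeff (suc k) (a ∷ p) = coeff k p

module PZ = Poly (+ 0) ℤ._+_ ℤ._*_
Polyℤ : Set
Polyℤ = PZ.P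

-- ℤ[x][y] : polynomials in y with coefficients in ℤ[x]
module PZZ = Poly {Polyℤ} [] PZ.add PZ.mul
Poly2 : Set
Poly2 = PZZ.P

one2 : Poly2
one2 = (+ 1 ∷ []) ∷ []

xMinus1 : Poly2
xMinus1 = (-[1+ 0 ] ∷ + 1 ∷ []) ∷ []

yMinus1 : Poly2
yMinus1 = (-[1+ 0 ] ∷ []) ∷ (+ 1 ∷ []) ∷ []

pow2 : Poly2 → ℕ → Poly2
pow2 p k = PZZ.pow p (+ 1 ∷ []) k

tutte : {n : ℕ} → Matroid n → Poly2
tutte {n} M = foldr PZZ.add []
  (map (λ A → PZZ.mul (pow2 xMinus1 (rank M ∸ rk A))
                      (pow2 yMinus1 (∣ A ∣ ∸ rk A)))
       (allSubsets n))
  where open Matroid M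

tutteY1 : {n : ℕ} → Matroid n → Polyℤ
tutteY1 M = PZZ.evalAt1 (tutte M)

coeffℤ : ℤ → Polyℤ → ℤ
coeffℤ (+ k)    f = PZ.coeff k f
coeffℤ -[1+ k ] f = + 0

-- binomial coefficient for integer arguments: C(a,b) = 0 unless 0 ≤ b ≤ a
binomℤ : ℤ → ℤ → ℤ
binomℤ (+ a)    (+ b)    = + (a C b)
binomℤ (+ a)    -[1+ b ] = + 0
binomℤ -[1+ a ] _        = + 0

sumCircuitsBelow : {n : ℕ} → Matroid n → ℕ → (Subset n → ℤ) → ℤ
sumCircuitsBelow {n} M d g = sumℤ (map g (filter P? (allSubsets n)))
  where
  isCircuit? : (C : Subset n) → Dec (IsCircuit M C)
  isCircuit? C = (Matroid.rk M C ℕ.+ 1 ℕ.≟ ∣ C ∣)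
    ×-dec all? (λ e → (e ∈? C) →-dec (Matroid.rk M (C - e) ℕ.+ 1 ℕ.≟ ∣ C ∣))
  P? : (C : Subset n) → Dec (IsCircuit M C × ∣ C ∣ ℕ.< d)
  P? C = isCircuit? C ×-dec (∣ C ∣ ℕ.<? d)

-- Only independent sets A contribute to T_M(x,1), each with (x-1)^(r-|A|), whose coefficient of
-- x^i is gbinom (-1-i) (r-i-|A|), where gbinom extends (s choose t) to negative s so that Pascal's
-- rule holds on all of ℤ × ℤ. So [x^i] T_M(x,1) = Σ_{A independent} h |A| for
-- h j = gbinom (-1-i) (r-i-j), and i > r - d₂ makes h vanish from d₂ on.
--
-- A set of size < d₂ is independent or contains exactly one circuit: two distinct circuits meet
-- in an independent set, so their union has nullity ≥ 2 and hence size ≥ d₂. The sum over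
-- independent sets is therefore the sum over all sets minus, for each circuit C with |C| < d₂,
-- the sum over the supersets of C. Both are binomial transforms of h, evaluated by Vandermonde's
-- identity Σ_j (N choose j) · gbinom a (b-j) = gbinom (a+N) b; since r + 2 ≤ n the results are
-- ordinary binomial coefficients, the circuit terms after the symmetry (a choose b) = (a choose a-b).

module Submission where

open import Defs
open import Data.Bool using (true; false; if_then_else_)
open import Data.Bool.Properties using (if-eta)
open import Data.Nat as ℕ using (ℕ; zero; suc; _∸_; _≤_; z≤n; s≤s)
import Data.Nat.Properties as ℕₚ
open import Data.Vec using ([]; _∷_; tail; here; there)
open import Data.Fin using (Fin)
open import Data.Product using (∃; _×_; _,_; proj₁; proj₂)
open import Data.Sum using (_⊎_; inj₁; inj₂; [_,_]′)
open import Data.Empty using (⊥-elim)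
open import Function using (_∘_)
open import Relation.Nullary using (¬_; does; yes; no; contradiction)
open import Relation.Unary using (Decidable)
open import Relation.Binary.PropositionalEquality

module SubsetProperties where

  open import Data.Nat using (_+_; _<_)
  open import Data.Fin.Properties using (¬∀⟶∃¬)
  open import Data.Fin.Subset
  open import Data.Fin.Subset.Properties
  open import Relation.Nullary.Decidable using (decidable-stable; _→-dec_)

  private
    variable
      n : ℕ

  ∪-─-⊆ : ∀ {p q : Subset n} → p ⊆ q → p ∪ (q ─ p) ≡ q
  ∪-─-⊆ {p = []}          {[]}          _   = refl
  ∪-─-⊆ {p = outside ∷ p} {outside ∷ q} p⊆q = cong (outside ∷_) (∪-─-⊆ (drop-∷-⊆ p⊆q))
  ∪-─-⊆ {p = outside ∷ p} {inside ∷ q}  p⊆q = cong (inside ∷_) (∪-─-⊆ (drop-∷-⊆ p⊆q))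
  ∪-─-⊆ {p = inside ∷ p}  {inside ∷ q}  p⊆q = cong (inside ∷_) (∪-─-⊆ (drop-∷-⊆ p⊆q))
  ∪-─-⊆ {p = inside ∷ p}  {outside ∷ q} p⊆q with () ← p⊆q here

  ∣p∣+∣q─p∣≡∣q∣ : ∀ {p q : Subset n} → p ⊆ q → ∣ p ∣ + ∣ q ─ p ∣ ≡ ∣ q ∣
  ∣p∣+∣q─p∣≡∣q∣ {p = []}          {[]}          _   = refl
  ∣p∣+∣q─p∣≡∣q∣ {p = outside ∷ p} {outside ∷ q} p⊆q = ∣p∣+∣q─p∣≡∣q∣ (drop-∷-⊆ p⊆q)
  ∣p∣+∣q─p∣≡∣q∣ {p = outside ∷ p} {inside ∷ q}  p⊆q =
    trans (ℕₚ.+-suc ∣ p ∣ _) (cong suc (∣p∣+∣q─p∣≡∣q∣ (drop-∷-⊆ p⊆q)))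
  ∣p∣+∣q─p∣≡∣q∣ {p = inside ∷ p}  {inside ∷ q}  p⊆q = cong suc (∣p∣+∣q─p∣≡∣q∣ (drop-∷-⊆ p⊆q))
  ∣p∣+∣q─p∣≡∣q∣ {p = inside ∷ p}  {outside ∷ q} p⊆q with () ← p⊆q here

  ∣p∪q∣+∣p∩q∣≡∣p∣+∣q∣ : ∀ (p q : Subset n) → ∣ p ∪ q ∣ + ∣ p ∩ q ∣ ≡ ∣ p ∣ + ∣ q ∣
  ∣p∪q∣+∣p∩q∣≡∣p∣+∣q∣ []            []            = refl
  ∣p∪q∣+∣p∩q∣≡∣p∣+∣q∣ (outside ∷ p) (outside ∷ q) = ∣p∪q∣+∣p∩q∣≡∣p∣+∣q∣ p q
  ∣p∪q∣+∣p∩q∣≡∣p∣+∣q∣ (outside ∷ p) (inside ∷ q)  =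
    trans (cong suc (∣p∪q∣+∣p∩q∣≡∣p∣+∣q∣ p q)) (sym (ℕₚ.+-suc ∣ p ∣ ∣ q ∣))
  ∣p∪q∣+∣p∩q∣≡∣p∣+∣q∣ (inside ∷ p)  (outside ∷ q) = cong suc (∣p∪q∣+∣p∩q∣≡∣p∣+∣q∣ p q)
  ∣p∪q∣+∣p∩q∣≡∣p∣+∣q∣ (inside ∷ p)  (inside ∷ q)  = cong suc (begin
    ∣ p ∪ q ∣ + suc ∣ p ∩ q ∣ ≡⟨ ℕₚ.+-suc ∣ p ∪ q ∣ ∣ p ∩ q ∣ ⟩
    suc (∣ p ∪ q ∣ + ∣ p ∩ q ∣) ≡⟨ cong suc (∣p∪q∣+∣p∩q∣≡∣p∣+∣q∣ p q) ⟩
    suc (∣ p ∣ + ∣ q ∣)         ≡⟨ sym (ℕₚ.+-suc ∣ p ∣ ∣ q ∣) ⟩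
    ∣ p ∣ + suc ∣ q ∣           ∎)
    where open ≡-Reasoning

  x∈p⇒suc∣p-x∣≡∣p∣ : ∀ {p : Subset n} {x} → x ∈ p → suc ∣ p - x ∣ ≡ ∣ p ∣
  x∈p⇒suc∣p-x∣≡∣p∣ {p = inside ∷ p}  here      = cong (suc ∘ ∣_∣) (p─⊥≡p p)
  x∈p⇒suc∣p-x∣≡∣p∣ {p = inside ∷ p}  (there x∈p) = cong suc (x∈p⇒suc∣p-x∣≡∣p∣ x∈p)
  x∈p⇒suc∣p-x∣≡∣p∣ {p = outside ∷ p} (there x∈p) = x∈p⇒suc∣p-x∣≡∣p∣ x∈p

  0<∣p∣⇒Nonempty : ∀ {p : Subset n} → 0 < ∣ p ∣ → Nonempty p
  0<∣p∣⇒Nonempty {n} {p} 0<∣p∣ with nonempty? p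
  ... | yes p≢∅ = p≢∅
  ... | no  p≡∅ = contradiction (trans (cong ∣_∣ (Empty-unique p≡∅)) (∣⊥∣≡0 n)) (ℕₚ.n>0⇒n≢0 0<∣p∣)

  ¬∀∈⇒∃∈¬ : ∀ {p : Subset n} {P : Fin n → Set} → Decidable P →
            ¬ (∀ x → x ∈ p → P x) → ∃ λ x → x ∈ p × ¬ P x
  ¬∀∈⇒∃∈¬ {n} {p} {P} P? ¬∀ with ¬∀⟶∃¬ n _ (λ x → x ∈? p →-dec P? x) ¬∀
  ... | x , ¬[x∈p→Px] =
    x , decidable-stable (x ∈? p) (λ x∉p → ¬[x∈p→Px] (⊥-elim ∘ x∉p)) , λ Px → ¬[x∈p→Px] (λ _ → Px)

  ⊈⇒∃∈∉ : ∀ {p q : Subset n} → ¬ p ⊆ q → ∃ λ x → x ∈ p × x ∉ q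
  ⊈⇒∃∈∉ {q = q} p⊈q = ¬∀∈⇒∃∈¬ (_∈? q) (λ p⊆q → p⊈q (p⊆q _))

  p⊆r∧q⊆r⇒p∪q⊆r : ∀ {p q r : Subset n} → p ⊆ r → q ⊆ r → p ∪ q ⊆ r
  p⊆r∧q⊆r⇒p∪q⊆r {p = p} {q} p⊆r q⊆r x∈p∪q = [ p⊆r , q⊆r ]′ (x∈p∪q⁻ p q x∈p∪q)

module MatroidProperties {n : ℕ} (M : Matroid n) where

  open import Data.Nat using (_+_; _<_; _≤?_; _≟_)
  open import Data.Nat.Induction using (<-wellFounded)
  open import Data.Nat.Tactic.RingSolver using (solve-∀)
  open import Data.Fin.Properties using (any?; all?)
  open import Data.Fin.Subset
  open import Data.Fin.Subset.Properties
  open import Induction.WellFounded using (Acc; acc)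
  open import Relation.Nullary.Decidable using (decidable-stable; _×-dec_; _→-dec_; ¬?)
  open SubsetProperties
  open Matroid M

  Independent : Subset n → Set
  Independent A = ∣ A ∣ ≤ rk A

  rk≤rank : ∀ A → rk A ≤ rank M
  rk≤rank A = rk-mono ⊆⊤

  nullity-mono : ∀ {A B} → A ⊆ B → ∣ A ∣ + rk B ≤ ∣ B ∣ + rk A
  nullity-mono {A} {B} A⊆B = begin
    ∣ A ∣ + rk B                         ≡⟨ cong (λ X → ∣ A ∣ + rk X) (sym (∪-─-⊆ A⊆B)) ⟩
    ∣ A ∣ + rk (A ∪ D)                   ≤⟨ ℕₚ.+-monoʳ-≤ (∣ A ∣) (ℕₚ.m≤m+n (rk (A ∪ D)) (rk (A ∩ D))) ⟩
    ∣ A ∣ + (rk (A ∪ D) + rk (A ∩ D))    ≤⟨ ℕₚ.+-monoʳ-≤ (∣ A ∣) (rk-submod A D) ⟩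
    ∣ A ∣ + (rk A + rk D)                ≤⟨ ℕₚ.+-monoʳ-≤ (∣ A ∣) (ℕₚ.+-monoʳ-≤ (rk A) (rk-bound D)) ⟩
    ∣ A ∣ + (rk A + ∣ D ∣)               ≡⟨ rearrange (∣ A ∣) (rk A) (∣ D ∣) ⟩
    (∣ A ∣ + ∣ D ∣) + rk A               ≡⟨ cong (_+ rk A) (∣p∣+∣q─p∣≡∣q∣ A⊆B) ⟩
    ∣ B ∣ + rk A                         ∎
    where
    open ℕₚ.≤-Reasoning
    D = B ─ A
    rearrange : ∀ a r d → a + (r + d) ≡ (a + d) + r
    rearrange = solve-∀

  independent-⊆ : ∀ {A B} → A ⊆ B → Independent B → Independent A
  independent-⊆ {A} {B} A⊆B indB = ℕₚ.+-cancelʳ-≤ (rk B) (∣ A ∣) (rk A) (begin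
    ∣ A ∣ + rk B   ≤⟨ nullity-mono A⊆B ⟩
    ∣ B ∣ + rk A   ≤⟨ ℕₚ.+-monoˡ-≤ (rk A) indB ⟩
    rk B + rk A    ≡⟨ ℕₚ.+-comm (rk B) (rk A) ⟩
    rk A + rk B    ∎)
    where open ℕₚ.≤-Reasoning

  circuit-dependent : ∀ {C} → IsCircuit M C → ¬ Independent C
  circuit-dependent {C} (rkC+1≡∣C∣ , _) = ℕₚ.<⇒≱ (subst (rk C <_) rkC+1≡∣C∣ (ℕₚ.m<m+n (rk C) (s≤s z≤n)))

  circuit-⊂-independent : ∀ {C A x} → IsCircuit M C → A ⊆ C → x ∈ C → x ∉ A → Independent A
  circuit-⊂-independent {C} {A} {x} (_ , rk[C-y]+1≡∣C∣) A⊆C x∈C x∉A = independent-⊆ A⊆C-x C-x-independent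
    where
    A⊆C-x : A ⊆ C - x
    A⊆C-x y∈A = x∈p∧x≢y⇒x∈p-y (A⊆C y∈A) (λ { refl → x∉A y∈A })
    C-x-independent : Independent (C - x)
    C-x-independent = ℕₚ.≤-reflexive (ℕₚ.suc-injective (begin
      suc ∣ C - x ∣      ≡⟨ x∈p⇒suc∣p-x∣≡∣p∣ x∈C ⟩
      ∣ C ∣              ≡⟨ sym (rk[C-y]+1≡∣C∣ x x∈C) ⟩
      rk (C - x) + 1     ≡⟨ ℕₚ.+-comm (rk (C - x)) 1 ⟩
      suc (rk (C - x))   ∎))
      where open ≡-Reasoning

  minimal-dependent⇒circuit : ∀ {A} → ¬ Independent A → (∀ x → x ∈ A → Independent (A - x)) → IsCircuit M A
  minimal-dependent⇒circuit {A} dep deletions = rkA+1≡∣A∣ , rk[A-x]+1≡∣A∣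
    where
    rk[A-x]+1≡∣A∣ : ∀ x → x ∈ A → rk (A - x) + 1 ≡ ∣ A ∣
    rk[A-x]+1≡∣A∣ x x∈A = trans (ℕₚ.+-comm (rk (A - x)) 1)
      (trans (cong suc (ℕₚ.≤-antisym (rk-bound (A - x)) (deletions x x∈A))) (x∈p⇒suc∣p-x∣≡∣p∣ x∈A))
    rkA<∣A∣ : rk A < ∣ A ∣
    rkA<∣A∣ = ℕₚ.≰⇒> dep
    rkA+1≡∣A∣ : rk A + 1 ≡ ∣ A ∣
    rkA+1≡∣A∣ with x , x∈A ← 0<∣p∣⇒Nonempty (ℕₚ.≤-<-trans z≤n rkA<∣A∣) = ℕₚ.≤-antisym
      (subst (_≤ ∣ A ∣) (ℕₚ.+-comm 1 (rk A)) rkA<∣A∣)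
      (subst (_≤ rk A + 1) (rk[A-x]+1≡∣A∣ x x∈A) (ℕₚ.+-monoˡ-≤ 1 (rk-mono (p─q⊆p A ⁅ x ⁆))))

  dependent⇒circuit-⊆ : ∀ A → ¬ Independent A → ∃ λ C → IsCircuit M C × C ⊆ A
  dependent⇒circuit-⊆ A = go A (<-wellFounded ∣ A ∣)
    where
    go : ∀ A → Acc _<_ ∣ A ∣ → ¬ Independent A → ∃ λ C → IsCircuit M C × C ⊆ A
    go A (acc rec) dep with any? (λ x → x ∈? A ×-dec ¬? (∣ A - x ∣ ≤? rk (A - x)))
    ... | yes (x , x∈A , dep′) with C , circ , C⊆A-x ← go (A - x) (rec (x∈p⇒∣p-x∣<∣p∣ x∈A)) dep′ =
      C , circ , ⊆-trans C⊆A-x (p─q⊆p A ⁅ x ⁆)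
    ... | no ¬∃ = A , minimal-dependent⇒circuit dep deletions , ⊆-refl
      where
      deletions : ∀ x → x ∈ A → Independent (A - x)
      deletions x x∈A = decidable-stable (∣ A - x ∣ ≤? rk (A - x)) (λ dep′ → ¬∃ (x , x∈A , dep′))

  circuits-∪-nullity≥2 : ∀ {C₁ C₂} → IsCircuit M C₁ → IsCircuit M C₂ → Independent (C₁ ∩ C₂) →
                         rk (C₁ ∪ C₂) + 2 ≤ ∣ C₁ ∪ C₂ ∣
  circuits-∪-nullity≥2 {C₁} {C₂} (rkC₁+1≡∣C₁∣ , _) (rkC₂+1≡∣C₂∣ , _) ind =
    ℕₚ.+-cancelʳ-≤ (∣ C₁ ∩ C₂ ∣) (rk (C₁ ∪ C₂) + 2) (∣ C₁ ∪ C₂ ∣) (begin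
      rk (C₁ ∪ C₂) + 2 + ∣ C₁ ∩ C₂ ∣         ≤⟨ ℕₚ.+-monoʳ-≤ (rk (C₁ ∪ C₂) + 2) ind ⟩
      rk (C₁ ∪ C₂) + 2 + rk (C₁ ∩ C₂)        ≡⟨ rearrange (rk (C₁ ∪ C₂)) (rk (C₁ ∩ C₂)) ⟩
      (rk (C₁ ∪ C₂) + rk (C₁ ∩ C₂)) + 2      ≤⟨ ℕₚ.+-monoˡ-≤ 2 (rk-submod C₁ C₂) ⟩
      (rk C₁ + rk C₂) + 2                    ≡⟨ rearrange′ (rk C₁) (rk C₂) ⟩
      (rk C₁ + 1) + (rk C₂ + 1)              ≡⟨ cong₂ _+_ rkC₁+1≡∣C₁∣ rkC₂+1≡∣C₂∣ ⟩
      ∣ C₁ ∣ + ∣ C₂ ∣                        ≡⟨ sym (∣p∪q∣+∣p∩q∣≡∣p∣+∣q∣ C₁ C₂) ⟩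
      ∣ C₁ ∪ C₂ ∣ + ∣ C₁ ∩ C₂ ∣              ∎)
    where
    open ℕₚ.≤-Reasoning
    rearrange : ∀ u i → u + 2 + i ≡ (u + i) + 2
    rearrange = solve-∀
    rearrange′ : ∀ a b → (a + b) + 2 ≡ (a + 1) + (b + 1)
    rearrange′ = solve-∀

  distinct-circuits-∩-independent : ∀ {C₁ C₂} → IsCircuit M C₁ → IsCircuit M C₂ → C₁ ≢ C₂ →
                                    Independent (C₁ ∩ C₂)
  distinct-circuits-∩-independent {C₁} {C₂} circ₁ circ₂ C₁≢C₂ with C₁ ⊆? C₂ | C₂ ⊆? C₁
  ... | yes C₁⊆C₂ | yes C₂⊆C₁ = contradiction (⊆-antisym C₁⊆C₂ C₂⊆C₁) C₁≢C₂
  ... | no C₁⊈C₂  | _ with x , x∈C₁ , x∉C₂ ← ⊈⇒∃∈∉ C₁⊈C₂ =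
    circuit-⊂-independent circ₁ (p∩q⊆p C₁ C₂) x∈C₁ (x∉C₂ ∘ proj₂ ∘ x∈p∩q⁻ C₁ C₂)
  ... | yes _     | no C₂⊈C₁ with x , x∈C₂ , x∉C₁ ← ⊈⇒∃∈∉ C₂⊈C₁ =
    circuit-⊂-independent circ₂ (p∩q⊆q C₁ C₂) x∈C₂ (x∉C₁ ∘ proj₁ ∘ x∈p∩q⁻ C₁ C₂)

  module _ {d : ℕ} (d-is-d₂ : IsDk M 2 d) where

    nullity≥2-shrinks : ∀ B → rk B + 2 ≤ ∣ B ∣ →
      (InD M B × rk B + 2 ≡ ∣ B ∣) ⊎ (∃ λ x → x ∈ B × rk (B - x) + 2 ≤ ∣ B - x ∣)
    nullity≥2-shrinks B null≥2 with rk B + 2 ≟ ∣ B ∣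
    ... | no null≢2 with x , x∈B ← 0<∣p∣⇒Nonempty (ℕₚ.<-≤-trans (s≤s z≤n) (ℕₚ.≤-trans (ℕₚ.m≤n+m 2 (rk B)) null≥2)) =
      inj₂ (x , x∈B , ℕₚ.≤-pred (begin
        suc (rk (B - x) + 2) ≤⟨ s≤s (ℕₚ.+-monoˡ-≤ 2 (rk-mono (p─q⊆p B ⁅ x ⁆))) ⟩
        suc (rk B + 2)       ≤⟨ ℕₚ.≤∧≢⇒< null≥2 null≢2 ⟩
        ∣ B ∣                ≡⟨ sym (x∈p⇒suc∣p-x∣≡∣p∣ x∈B) ⟩
        suc ∣ B - x ∣        ∎))
      where open ℕₚ.≤-Reasoning
    ... | yes null≡2 with all? (λ x → x ∈? B →-dec rk (B - x) ≟ rk B)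
    ...   | yes inD  = inj₁ (inD , null≡2)
    ...   | no ¬inD with x , x∈B , rk≢ ← ¬∀∈⇒∃∈¬ (λ x → rk (B - x) ≟ rk B) ¬inD =
      inj₂ (x , x∈B , ℕₚ.≤-pred (begin
        suc (rk (B - x)) + 2 ≤⟨ ℕₚ.+-monoˡ-≤ 2 (ℕₚ.≤∧≢⇒< (rk-mono (p─q⊆p B ⁅ x ⁆)) rk≢) ⟩
        rk B + 2             ≡⟨ null≡2 ⟩
        ∣ B ∣                ≡⟨ sym (x∈p⇒suc∣p-x∣≡∣p∣ x∈B) ⟩
        suc ∣ B - x ∣        ∎))
      where open ℕₚ.≤-Reasoning

    nullity≥2⇒d≤∣B∣ : ∀ B → rk B + 2 ≤ ∣ B ∣ → d ≤ ∣ B ∣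
    nullity≥2⇒d≤∣B∣ B = go B (<-wellFounded ∣ B ∣)
      where
      go : ∀ B → Acc _<_ ∣ B ∣ → rk B + 2 ≤ ∣ B ∣ → d ≤ ∣ B ∣
      go B (acc rec) null≥2 with nullity≥2-shrinks B null≥2
      ... | inj₁ (inD , null≡2)        = proj₂ d-is-d₂ B inD null≡2
      ... | inj₂ (x , x∈B , null′≥2) =
        ℕₚ.<⇒≤ (ℕₚ.≤-<-trans (go (B - x) (rec (x∈p⇒∣p-x∣<∣p∣ x∈B)) null′≥2) (x∈p⇒∣p-x∣<∣p∣ x∈B))

    distinct-circuits⇒d≤∣∪∣ : ∀ {C₁ C₂} → IsCircuit M C₁ → IsCircuit M C₂ → C₁ ≢ C₂ → d ≤ ∣ C₁ ∪ C₂ ∣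
    distinct-circuits⇒d≤∣∪∣ circ₁ circ₂ C₁≢C₂ = nullity≥2⇒d≤∣B∣ _
      (circuits-∪-nullity≥2 circ₁ circ₂ (distinct-circuits-∩-independent circ₁ circ₂ C₁≢C₂))

    2+rank≤n : 2 + rank M ≤ n
    2+rank≤n with A , _ , rkA+2≡∣A∣ , _ ← proj₁ d-is-d₂ =
      ℕₚ.+-cancelˡ-≤ (rk A) (2 + rank M) n (begin
        rk A + (2 + rank M)   ≡⟨ rearrange (rk A) (rank M) ⟩
        (rk A + 2) + rank M   ≡⟨ cong (_+ rank M) rkA+2≡∣A∣ ⟩
        ∣ A ∣ + rank M        ≤⟨ nullity-mono ⊆⊤ ⟩
        ∣ ⊤ {n} ∣ + rk A      ≡⟨ cong (_+ rk A) (∣⊤∣≡n n) ⟩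
        n + rk A              ≡⟨ ℕₚ.+-comm n (rk A) ⟩
        rk A + n              ∎)
      where
      open ℕₚ.≤-Reasoning
      rearrange : ∀ a r → a + (2 + r) ≡ (a + 2) + r
      rearrange = solve-∀

open import Data.Nat.Combinatorics using (nCk+nC[k+1]≡[n+1]C[k+1]; nCn≡1; nCk≡nC[n∸k]; k>n⇒nCk≡0)
  renaming (_C_ to _choose_)
open import Data.Integer using (ℤ; +_; -[1+_]; -1ℤ; 0ℤ; 1ℤ; _+_; _-_; -_; _*_; _^_; _<_)
import Data.Integer as ℤ
import Data.Integer.Properties as ℤₚ
open import Data.Integer.Tactic.RingSolver using (solve-∀)
open import Algebra.Properties.CommutativeSemigroup ℤₚ.+-commutativeSemigroup
  using () renaming (interchange to +-interchange)
open import Data.List using (List; []; _∷_; map; foldr; filter; _++_)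
open import Data.Fin.Subset using (Subset; ∣_∣)
open import Data.Fin.Subset.Properties using (_⊆?_; ∣p∣≤n; p⊆q⇒∣p∣≤∣q∣)
open SubsetProperties using (p⊆r∧q⊆r⇒p∪q⊆r)
open PZ using (add; scale; mul; coeff)

private
  variable
    X Y : Set

∑ : List X → (X → ℤ) → ℤ
∑ L f = sumℤ (map f L)

∑-cong : ∀ (L : List X) {f g} → (∀ x → f x ≡ g x) → ∑ L f ≡ ∑ L g
∑-cong []      f≗g = refl
∑-cong (x ∷ L) f≗g = cong₂ _+_ (f≗g x) (∑-cong L f≗g)

∑-zero : ∀ (L : List X) {f} → (∀ x → f x ≡ 0ℤ) → ∑ L f ≡ 0ℤ
∑-zero []      f≗0 = refl
∑-zero (x ∷ L) f≗0 = cong₂ _+_ (f≗0 x) (∑-zero L f≗0)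

∑-++ : ∀ (L L′ : List X) f → ∑ (L ++ L′) f ≡ ∑ L f + ∑ L′ f
∑-++ []      L′ f = sym (ℤₚ.+-identityˡ _)
∑-++ (x ∷ L) L′ f = trans (cong (_+_ (f x)) (∑-++ L L′ f)) (sym (ℤₚ.+-assoc (f x) _ _))

∑-map : ∀ (L : List Y) (g : Y → X) f → ∑ (map g L) f ≡ ∑ L (f ∘ g)
∑-map []      g f = refl
∑-map (y ∷ L) g f = cong (_+_ (f (g y))) (∑-map L g f)

∑-- : ∀ (L : List X) f g → ∑ L (λ x → f x - g x) ≡ ∑ L f - ∑ L g
∑-- []      f g = refl
∑-- (x ∷ L) f g = trans (cong (_+_ (f x - g x)) (∑-- L f g)) (interchange (f x) (g x) _ _)
  where
  interchange : ∀ a b c d → (a - b) + (c - d) ≡ (a + c) - (b + d)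
  interchange = solve-∀

∑-+ : ∀ (L : List X) f g → ∑ L (λ x → f x + g x) ≡ ∑ L f + ∑ L g
∑-+ []      f g = refl
∑-+ (x ∷ L) f g = trans (cong (_+_ (f x + g x)) (∑-+ L f g)) (+-interchange (f x) (g x) _ _)

∑-comm : ∀ (L : List X) (L′ : List Y) (F : X → Y → ℤ) →
         ∑ L (λ x → ∑ L′ (F x)) ≡ ∑ L′ (λ y → ∑ L (λ x → F x y))
∑-comm []      L′ F = sym (∑-zero L′ (λ _ → refl))
∑-comm (x ∷ L) L′ F =
  trans (cong (_+_ (∑ L′ (F x))) (∑-comm L L′ F)) (sym (∑-+ L′ (F x) (λ y → ∑ L (λ x′ → F x′ y))))

∑-filter : ∀ {P : X → Set} (P? : Decidable P) (L : List X) g →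
           ∑ (filter P? L) g ≡ ∑ L (λ x → if does (P? x) then g x else 0ℤ)
∑-filter P? []      g = refl
∑-filter P? (x ∷ L) g with does (P? x)
... | true  = cong (_+_ (g x)) (∑-filter P? L g)
... | false = trans (∑-filter P? L g) (sym (ℤₚ.+-identityˡ _))

∑-allSubsets-suc : ∀ n (f : Subset (suc n) → ℤ) →
  ∑ (allSubsets (suc n)) f ≡ ∑ (allSubsets n) (f ∘ (false ∷_)) + ∑ (allSubsets n) (f ∘ (true ∷_))
∑-allSubsets-suc n f = trans (∑-++ (map (false ∷_) (allSubsets n)) _ f)
  (cong₂ _+_ (∑-map (allSubsets n) (false ∷_) f) (∑-map (allSubsets n) (true ∷_) f))

∑-allSubsets-single : ∀ {n} (f : Subset n → ℤ) B → (∀ A → A ≢ B → f A ≡ 0ℤ) → ∑ (allSubsets n) f ≡ f B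
∑-allSubsets-single {zero}  f []          f≗0 = ℤₚ.+-identityʳ (f [])
∑-allSubsets-single {suc n} f (false ∷ B) f≗0 = begin
  ∑ (allSubsets (suc n)) f
    ≡⟨ ∑-allSubsets-suc n f ⟩
  ∑ (allSubsets n) (f ∘ (false ∷_)) + ∑ (allSubsets n) (f ∘ (true ∷_))
    ≡⟨ cong₂ _+_ (∑-allSubsets-single (f ∘ (false ∷_)) B (λ A A≢B → f≗0 (false ∷ A) (A≢B ∘ cong tail)))
                 (∑-zero (allSubsets n) (λ A → f≗0 (true ∷ A) (λ ()))) ⟩
  f (false ∷ B) + 0ℤ
    ≡⟨ ℤₚ.+-identityʳ _ ⟩
  f (false ∷ B) ∎
  where open ≡-Reasoning
∑-allSubsets-single {suc n} f (true ∷ B)  f≗0 = begin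
  ∑ (allSubsets (suc n)) f
    ≡⟨ ∑-allSubsets-suc n f ⟩
  ∑ (allSubsets n) (f ∘ (false ∷_)) + ∑ (allSubsets n) (f ∘ (true ∷_))
    ≡⟨ cong₂ _+_ (∑-zero (allSubsets n) (λ A → f≗0 (false ∷ A) (λ ())))
                 (∑-allSubsets-single (f ∘ (true ∷_)) B (λ A A≢B → f≗0 (true ∷ A) (A≢B ∘ cong tail))) ⟩
  0ℤ + f (true ∷ B)
    ≡⟨ ℤₚ.+-identityˡ _ ⟩
  f (true ∷ B) ∎
  where open ≡-Reasoning

-- Unfolding the recursion along Pascal's rule: binomialSum N g = Σ_j (N choose j) · g j.
binomialSum : ℕ → (ℕ → ℤ) → ℤ
binomialSum zero    g = g 0
binomialSum (suc N) g = binomialSum N g + binomialSum N (g ∘ suc)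

binomialSum-cong : ∀ N {f g} → (∀ j → f j ≡ g j) → binomialSum N f ≡ binomialSum N g
binomialSum-cong zero    f≗g = f≗g 0
binomialSum-cong (suc N) f≗g = cong₂ _+_ (binomialSum-cong N f≗g) (binomialSum-cong N (f≗g ∘ suc))

∑-allSubsets-card : ∀ n (f : ℕ → ℤ) → ∑ (allSubsets n) (f ∘ ∣_∣) ≡ binomialSum n f
∑-allSubsets-card zero    f = ℤₚ.+-identityʳ (f 0)
∑-allSubsets-card (suc n) f = trans (∑-allSubsets-suc n (f ∘ ∣_∣))
  (cong₂ _+_ (∑-allSubsets-card n f) (∑-allSubsets-card n (f ∘ suc)))

∑-supersets-card : ∀ {n} (C : Subset n) (f : ℕ → ℤ) →
  ∑ (allSubsets n) (λ A → if does (C ⊆? A) then f ∣ A ∣ else 0ℤ) ≡ binomialSum (n ∸ ∣ C ∣) (λ j → f (∣ C ∣ ℕ.+ j))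
∑-supersets-card {zero}  []          f = ℤₚ.+-identityʳ (f 0)
∑-supersets-card {suc n} (true ∷ C)  f = begin
  ∑ (allSubsets (suc n)) (λ A → if does (true ∷ C ⊆? A) then f ∣ A ∣ else 0ℤ)
    ≡⟨ ∑-allSubsets-suc n _ ⟩
  ∑ (allSubsets n) (λ _ → 0ℤ) + ∑ (allSubsets n) (λ A → if does (C ⊆? A) then f (suc ∣ A ∣) else 0ℤ)
    ≡⟨ cong₂ _+_ (∑-zero (allSubsets n) (λ _ → refl)) (∑-supersets-card C (f ∘ suc)) ⟩
  0ℤ + binomialSum (n ∸ ∣ C ∣) (λ j → f (suc ∣ C ∣ ℕ.+ j))
    ≡⟨ ℤₚ.+-identityˡ _ ⟩
  binomialSum (n ∸ ∣ C ∣) (λ j → f (suc ∣ C ∣ ℕ.+ j)) ∎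
  where open ≡-Reasoning
∑-supersets-card {suc n} (false ∷ C) f = begin
  ∑ (allSubsets (suc n)) (λ A → if does (false ∷ C ⊆? A) then f ∣ A ∣ else 0ℤ)
    ≡⟨ ∑-allSubsets-suc n _ ⟩
  ∑ (allSubsets n) (λ A → if does (C ⊆? A) then f ∣ A ∣ else 0ℤ)
    + ∑ (allSubsets n) (λ A → if does (C ⊆? A) then f (suc ∣ A ∣) else 0ℤ)
    ≡⟨ cong₂ _+_ (∑-supersets-card C f) (∑-supersets-card C (f ∘ suc)) ⟩
  binomialSum (n ∸ c) (λ j → f (c ℕ.+ j)) + binomialSum (n ∸ c) (λ j → f (suc c ℕ.+ j))
    ≡⟨ cong (_+_ (binomialSum (n ∸ c) (λ j → f (c ℕ.+ j))))
            (binomialSum-cong (n ∸ c) (λ j → cong f (sym (ℕₚ.+-suc c j)))) ⟩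
  binomialSum (suc (n ∸ c)) (λ j → f (c ℕ.+ j))
    ≡⟨ cong (λ N → binomialSum N (λ j → f (c ℕ.+ j))) (sym (ℕₚ.+-∸-assoc 1 (∣p∣≤n C))) ⟩
  binomialSum (suc n ∸ c) (λ j → f (c ℕ.+ j)) ∎
  where
  open ≡-Reasoning
  c = ∣ C ∣

gbinom : ℤ → ℤ → ℤ
gbinom _        -[1+ _ ] = 0ℤ
gbinom (+ s)    (+ t)    = + (s choose t)
gbinom -[1+ s ] (+ t)    = -1ℤ ^ t * + ((s ℕ.+ t) choose t)

gbinom-pascal : ∀ a b → gbinom (ℤ.suc a) (ℤ.suc b) ≡ gbinom a (ℤ.suc b) + gbinom a b
gbinom-pascal a            -[1+ suc t ] = refl
gbinom-pascal (+ s)        -[1+ zero ]  = refl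
gbinom-pascal -[1+ zero ]  -[1+ zero ]  = refl
gbinom-pascal -[1+ suc s ] -[1+ zero ]  = refl
gbinom-pascal (+ s)        (+ t)        =
  cong +_ (trans (sym (nCk+nC[k+1]≡[n+1]C[k+1] s t)) (ℕₚ.+-comm (s choose t) (s choose suc t)))
gbinom-pascal -[1+ zero ] (+ t) =
  trans (cancel (-1ℤ ^ t)) (sym (cong₂ (λ x y → -1ℤ * -1ℤ ^ t * + x + -1ℤ ^ t * + y) (nCn≡1 (suc t)) (nCn≡1 t)))
  where
  cancel : ∀ σ → 0ℤ ≡ -1ℤ * σ * 1ℤ + σ * 1ℤ
  cancel = solve-∀
gbinom-pascal -[1+ suc s ] (+ t) rewrite ℕₚ.+-suc s t =
  trans (cancel (-1ℤ ^ t) (+ (m choose t)) (+ (m choose suc t)))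
        (cong (λ x → -1ℤ * -1ℤ ^ t * + x + -1ℤ ^ t * + (m choose t)) (nCk+nC[k+1]≡[n+1]C[k+1] m t))
  where
  m = suc (s ℕ.+ t)
  cancel : ∀ σ x y → -1ℤ * σ * y ≡ -1ℤ * σ * (x + y) + σ * x
  cancel = solve-∀

x≡y+z⇒y≡x-z : ∀ {x y z} → x ≡ y + z → y ≡ x - z
x≡y+z⇒y≡x-z {x} {y} {z} x≡y+z = trans (sym (y+z-z≡y y z)) (cong (_- z) (sym x≡y+z))
  where
  y+z-z≡y : ∀ y z → y + z - z ≡ y
  y+z-z≡y = solve-∀

gbinom-vandermonde : ∀ N a b → binomialSum N (λ j → gbinom a (b - + j)) ≡ gbinom (a + + N) b
gbinom-vandermonde zero    a b = cong₂ gbinom (sym (ℤₚ.+-identityʳ a)) (ℤₚ.+-identityʳ b)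
gbinom-vandermonde (suc N) a b = begin
  binomialSum N (λ j → gbinom a (b - + j)) + binomialSum N (λ j → gbinom a (b - + suc j))
    ≡⟨ cong (_+_ (binomialSum N (λ j → gbinom a (b - + j))))
            (binomialSum-cong N (λ j → cong (gbinom a) (shift b (+ j)))) ⟩
  binomialSum N (λ j → gbinom a (b - + j)) + binomialSum N (λ j → gbinom a (ℤ.pred b - + j))
    ≡⟨ cong₂ _+_ (gbinom-vandermonde N a b) (gbinom-vandermonde N a (ℤ.pred b)) ⟩
  gbinom (a + + N) b + gbinom (a + + N) (ℤ.pred b)
    ≡⟨ cong (λ c → gbinom (a + + N) c + gbinom (a + + N) (ℤ.pred b)) (sym (ℤₚ.suc-pred b)) ⟩
  gbinom (a + + N) (ℤ.suc (ℤ.pred b)) + gbinom (a + + N) (ℤ.pred b)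
    ≡⟨ sym (gbinom-pascal (a + + N) (ℤ.pred b)) ⟩
  gbinom (ℤ.suc (a + + N)) (ℤ.suc (ℤ.pred b))
    ≡⟨ cong₂ gbinom (suc-+ a (+ N)) (ℤₚ.suc-pred b) ⟩
  gbinom (a + + suc N) b ∎
  where
  open ≡-Reasoning
  shift : ∀ b x → b - (1ℤ + x) ≡ (-1ℤ + b) - x
  shift = solve-∀
  suc-+ : ∀ a x → 1ℤ + (a + x) ≡ a + (1ℤ + x)
  suc-+ = solve-∀

gbinom-negative : ∀ a {b} → b < 0ℤ → gbinom a b ≡ 0ℤ
gbinom-negative a { -[1+ _ ]} _         = refl
gbinom-negative a {+ _}       (ℤ.+<+ ())

gbinom≡binomℤ : ∀ a b m → a ≡ b + + m → gbinom a b ≡ binomℤ a b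
gbinom≡binomℤ (+ s)    (+ t)    m a≡b+m = refl
gbinom≡binomℤ (+ s)    -[1+ t ] m a≡b+m = refl
gbinom≡binomℤ -[1+ s ] -[1+ t ] m a≡b+m = refl

binomℤ-sym : ∀ a b m → a ≡ b + + m → binomℤ a b ≡ binomℤ a (+ m)
binomℤ-sym -[1+ s ] b        m a≡b+m = refl
binomℤ-sym (+ s)    (+ t)    m a≡b+m = cong +_ (begin
  s choose t                     ≡⟨ cong (_choose t) (ℤₚ.+-injective a≡b+m) ⟩
  (t ℕ.+ m) choose t             ≡⟨ nCk≡nC[n∸k] (ℕₚ.m≤m+n t m) ⟩
  (t ℕ.+ m) choose (t ℕ.+ m ∸ t) ≡⟨ cong ((t ℕ.+ m) choose_) (ℕₚ.m+n∸m≡n t m) ⟩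
  (t ℕ.+ m) choose m             ≡⟨ cong (_choose m) (ℤₚ.+-injective (sym a≡b+m)) ⟩
  s choose m                     ∎)
  where open ≡-Reasoning
binomℤ-sym (+ s)    -[1+ t ] m a≡b+m = cong +_ (sym (k>n⇒nCk≡0 (ℤₚ.drop‿+<+ s<m)))
  where
  s<m : + s < + m
  s<m = subst₂ _<_ (sym a≡b+m) (ℤₚ.+-identityˡ (+ m)) (ℤₚ.+-monoˡ-< (+ m) ℤ.-<+)

-- Coefficientwise equality: trailing zeros make the list representation of a polynomial non-unique.
infix 4 _≈_
_≈_ : Polyℤ → Polyℤ → Set
p ≈ q = ∀ k → coeff k p ≡ coeff k q

coeffℤ-cong : ∀ {p q} → p ≈ q → ∀ i → coeffℤ i p ≡ coeffℤ i q
coeffℤ-cong p≈q (+ k)    = p≈q k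
coeffℤ-cong p≈q -[1+ _ ] = refl

∷-cong : ∀ a {p q} → p ≈ q → a ∷ p ≈ a ∷ q
∷-cong a p≈q zero    = refl
∷-cong a p≈q (suc k) = p≈q k

coeff-add : ∀ k p q → coeff k (add p q) ≡ coeff k p + coeff k q
coeff-add k       []      q       = sym (ℤₚ.+-identityˡ _)
coeff-add k       (a ∷ p) []      = sym (ℤₚ.+-identityʳ _)
coeff-add zero    (a ∷ p) (b ∷ q) = refl
coeff-add (suc k) (a ∷ p) (b ∷ q) = coeff-add k p q

coeff-scale : ∀ k a q → coeff k (scale a q) ≡ a * coeff k q
coeff-scale k       a []      = sym (ℤₚ.*-zeroʳ a)
coeff-scale zero    a (b ∷ q) = refl
coeff-scale (suc k) a (b ∷ q) = coeff-scale k a q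

coeff-mul-∷ : ∀ k a p q → coeff k (mul (a ∷ p) q) ≡ a * coeff k q + coeff k (+ 0 ∷ mul p q)
coeff-mul-∷ k a p q = trans (coeff-add k (scale a q) (+ 0 ∷ mul p q)) (cong (_+ _) (coeff-scale k a q))

coeff-mul-const : ∀ k a q → coeff k (mul (a ∷ []) q) ≡ a * coeff k q
coeff-mul-const zero    a q = trans (coeff-mul-∷ 0 a [] q) (ℤₚ.+-identityʳ _)
coeff-mul-const (suc k) a q = trans (coeff-mul-∷ (suc k) a [] q) (ℤₚ.+-identityʳ _)

mul-zeroʳ : ∀ p {q} → q ≈ [] → mul p q ≈ []
mul-zeroʳ []          q≈0 k = refl
mul-zeroʳ (a ∷ p) {q} q≈0 k = begin
  coeff k (mul (a ∷ p) q)
    ≡⟨ coeff-mul-∷ k a p q ⟩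
  a * coeff k q + coeff k (+ 0 ∷ mul p q)
    ≡⟨ cong₂ _+_ (trans (cong (a *_) (q≈0 k)) (ℤₚ.*-zeroʳ a)) (∷-cong (+ 0) (mul-zeroʳ p q≈0) k) ⟩
  0ℤ + coeff k (+ 0 ∷ [])
    ≡⟨ trans (ℤₚ.+-identityˡ _) (coeff-zero k) ⟩
  0ℤ ∎
  where
  open ≡-Reasoning
  coeff-zero : ∀ k → coeff k (+ 0 ∷ []) ≡ 0ℤ
  coeff-zero zero    = refl
  coeff-zero (suc k) = refl

mul-identityʳ : ∀ p → mul p (+ 1 ∷ []) ≈ p
mul-identityʳ []      k       = refl
mul-identityʳ (a ∷ p) zero    = trans (coeff-mul-∷ 0 a p (+ 1 ∷ [])) (trans (ℤₚ.+-identityʳ _) (ℤₚ.*-identityʳ a))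
mul-identityʳ (a ∷ p) (suc k) = begin
  coeff (suc k) (mul (a ∷ p) (+ 1 ∷ []))        ≡⟨ coeff-mul-∷ (suc k) a p (+ 1 ∷ []) ⟩
  a * 0ℤ + coeff k (mul p (+ 1 ∷ []))           ≡⟨ cong (_+ _) (ℤₚ.*-zeroʳ a) ⟩
  0ℤ + coeff k (mul p (+ 1 ∷ []))               ≡⟨ ℤₚ.+-identityˡ _ ⟩
  coeff k (mul p (+ 1 ∷ []))                    ≡⟨ mul-identityʳ p k ⟩
  coeff k p                                     ∎
  where open ≡-Reasoning

mul-distribˡ : ∀ p q q′ → mul p (add q q′) ≈ add (mul p q) (mul p q′)
mul-distribˡ []      q q′ k = refl
mul-distribˡ (a ∷ p) q q′ k = begin
  coeff k (mul (a ∷ p) (add q q′))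
    ≡⟨ coeff-mul-∷ k a p (add q q′) ⟩
  a * coeff k (add q q′) + coeff k (+ 0 ∷ mul p (add q q′))
    ≡⟨ cong₂ _+_ (trans (cong (a *_) (coeff-add k q q′)) (ℤₚ.*-distribˡ-+ a _ _))
                 (trans (∷-cong (+ 0) (mul-distribˡ p q q′) k) (coeff-add k (+ 0 ∷ mul p q) (+ 0 ∷ mul p q′))) ⟩
  (a * coeff k q + a * coeff k q′) + (coeff k (+ 0 ∷ mul p q) + coeff k (+ 0 ∷ mul p q′))
    ≡⟨ +-interchange (a * coeff k q) (a * coeff k q′) (coeff k (+ 0 ∷ mul p q)) (coeff k (+ 0 ∷ mul p q′)) ⟩
  (a * coeff k q + coeff k (+ 0 ∷ mul p q)) + (a * coeff k q′ + coeff k (+ 0 ∷ mul p q′))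
    ≡⟨ sym (cong₂ _+_ (coeff-mul-∷ k a p q) (coeff-mul-∷ k a p q′)) ⟩
  coeff k (mul (a ∷ p) q) + coeff k (mul (a ∷ p) q′)
    ≡⟨ sym (coeff-add k (mul (a ∷ p) q) (mul (a ∷ p) q′)) ⟩
  coeff k (add (mul (a ∷ p) q) (mul (a ∷ p) q′)) ∎
  where open ≡-Reasoning

mul-distribʳ : ∀ p p′ q → mul (add p p′) q ≈ add (mul p q) (mul p′ q)
mul-distribʳ []      p′       q k = refl
mul-distribʳ (a ∷ p) []       q k = sym (trans (coeff-add k (mul (a ∷ p) q) []) (ℤₚ.+-identityʳ _))
mul-distribʳ (a ∷ p) (b ∷ p′) q k = begin
  coeff k (mul ((a + b) ∷ add p p′) q)
    ≡⟨ coeff-mul-∷ k (a + b) (add p p′) q ⟩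
  (a + b) * coeff k q + coeff k (+ 0 ∷ mul (add p p′) q)
    ≡⟨ cong₂ _+_ (ℤₚ.*-distribʳ-+ (coeff k q) a b)
                 (trans (∷-cong (+ 0) (mul-distribʳ p p′ q) k) (coeff-add k (+ 0 ∷ mul p q) (+ 0 ∷ mul p′ q))) ⟩
  (a * coeff k q + b * coeff k q) + (coeff k (+ 0 ∷ mul p q) + coeff k (+ 0 ∷ mul p′ q))
    ≡⟨ +-interchange (a * coeff k q) (b * coeff k q) (coeff k (+ 0 ∷ mul p q)) (coeff k (+ 0 ∷ mul p′ q)) ⟩
  (a * coeff k q + coeff k (+ 0 ∷ mul p q)) + (b * coeff k q + coeff k (+ 0 ∷ mul p′ q))
    ≡⟨ sym (cong₂ _+_ (coeff-mul-∷ k a p q) (coeff-mul-∷ k b p′ q)) ⟩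
  coeff k (mul (a ∷ p) q) + coeff k (mul (b ∷ p′) q)
    ≡⟨ sym (coeff-add k (mul (a ∷ p) q) (mul (b ∷ p′) q)) ⟩
  coeff k (add (mul (a ∷ p) q) (mul (b ∷ p′) q)) ∎
  where open ≡-Reasoning

evalAt1-add : ∀ P Q → PZZ.evalAt1 (PZZ.add P Q) ≈ add (PZZ.evalAt1 P) (PZZ.evalAt1 Q)
evalAt1-add []      Q       k = refl
evalAt1-add (a ∷ P) []      k = sym (trans (coeff-add k (PZZ.evalAt1 (a ∷ P)) []) (ℤₚ.+-identityʳ _))
evalAt1-add (a ∷ P) (b ∷ Q) k = begin
  coeff k (add (add a b) (PZZ.evalAt1 (PZZ.add P Q)))
    ≡⟨ coeff-add k (add a b) _ ⟩
  coeff k (add a b) + coeff k (PZZ.evalAt1 (PZZ.add P Q))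
    ≡⟨ cong₂ _+_ (coeff-add k a b) (trans (evalAt1-add P Q k) (coeff-add k (PZZ.evalAt1 P) (PZZ.evalAt1 Q))) ⟩
  (coeff k a + coeff k b) + (coeff k (PZZ.evalAt1 P) + coeff k (PZZ.evalAt1 Q))
    ≡⟨ +-interchange (coeff k a) (coeff k b) (coeff k (PZZ.evalAt1 P)) (coeff k (PZZ.evalAt1 Q)) ⟩
  (coeff k a + coeff k (PZZ.evalAt1 P)) + (coeff k b + coeff k (PZZ.evalAt1 Q))
    ≡⟨ sym (cong₂ _+_ (coeff-add k a (PZZ.evalAt1 P)) (coeff-add k b (PZZ.evalAt1 Q))) ⟩
  coeff k (PZZ.evalAt1 (a ∷ P)) + coeff k (PZZ.evalAt1 (b ∷ Q))
    ≡⟨ sym (coeff-add k (PZZ.evalAt1 (a ∷ P)) (PZZ.evalAt1 (b ∷ Q))) ⟩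
  coeff k (add (PZZ.evalAt1 (a ∷ P)) (PZZ.evalAt1 (b ∷ Q))) ∎
  where open ≡-Reasoning

evalAt1-scale : ∀ a Q → PZZ.evalAt1 (PZZ.scale a Q) ≈ mul a (PZZ.evalAt1 Q)
evalAt1-scale a []      k = sym (mul-zeroʳ a (λ _ → refl) k)
evalAt1-scale a (q ∷ Q) k = begin
  coeff k (add (mul a q) (PZZ.evalAt1 (PZZ.scale a Q)))
    ≡⟨ coeff-add k (mul a q) _ ⟩
  coeff k (mul a q) + coeff k (PZZ.evalAt1 (PZZ.scale a Q))
    ≡⟨ cong (_+_ (coeff k (mul a q))) (evalAt1-scale a Q k) ⟩
  coeff k (mul a q) + coeff k (mul a (PZZ.evalAt1 Q))
    ≡⟨ sym (coeff-add k (mul a q) (mul a (PZZ.evalAt1 Q))) ⟩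
  coeff k (add (mul a q) (mul a (PZZ.evalAt1 Q)))
    ≡⟨ sym (mul-distribˡ a q (PZZ.evalAt1 Q) k) ⟩
  coeff k (mul a (add q (PZZ.evalAt1 Q))) ∎
  where open ≡-Reasoning

evalAt1-mul : ∀ P Q → PZZ.evalAt1 (PZZ.mul P Q) ≈ mul (PZZ.evalAt1 P) (PZZ.evalAt1 Q)
evalAt1-mul []      Q k = refl
evalAt1-mul (a ∷ P) Q k = begin
  coeff k (PZZ.evalAt1 (PZZ.add (PZZ.scale a Q) ([] ∷ PZZ.mul P Q)))
    ≡⟨ trans (evalAt1-add (PZZ.scale a Q) _ k) (coeff-add k (PZZ.evalAt1 (PZZ.scale a Q)) (PZZ.evalAt1 (PZZ.mul P Q))) ⟩
  coeff k (PZZ.evalAt1 (PZZ.scale a Q)) + coeff k (PZZ.evalAt1 (PZZ.mul P Q))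
    ≡⟨ cong₂ _+_ (evalAt1-scale a Q k) (evalAt1-mul P Q k) ⟩
  coeff k (mul a (PZZ.evalAt1 Q)) + coeff k (mul (PZZ.evalAt1 P) (PZZ.evalAt1 Q))
    ≡⟨ sym (trans (mul-distribʳ a (PZZ.evalAt1 P) _ k) (coeff-add k (mul a (PZZ.evalAt1 Q)) (mul (PZZ.evalAt1 P) (PZZ.evalAt1 Q)))) ⟩
  coeff k (mul (add a (PZZ.evalAt1 P)) (PZZ.evalAt1 Q)) ∎
  where open ≡-Reasoning

coeff-xMinus1^ : ∀ m k → coeff k (PZZ.evalAt1 (pow2 xMinus1 m)) ≡ gbinom -[1+ k ] (+ m - + k)
coeff-xMinus1^ zero    zero    = refl
coeff-xMinus1^ zero    (suc k) = refl
coeff-xMinus1^ (suc m) zero    = begin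
  coeff 0 (PZZ.evalAt1 (pow2 xMinus1 (suc m)))
    ≡⟨ evalAt1-mul xMinus1 (pow2 xMinus1 m) 0 ⟩
  coeff 0 (mul (-1ℤ ∷ 1ℤ ∷ []) p)
    ≡⟨ trans (coeff-mul-∷ 0 -1ℤ (1ℤ ∷ []) p) (ℤₚ.+-identityʳ _) ⟩
  -1ℤ * coeff 0 p
    ≡⟨ cong (-1ℤ *_) (coeff-xMinus1^ m 0) ⟩
  -1ℤ * gbinom -1ℤ (+ m - + 0)
    ≡⟨ -1*x≡0-x (gbinom -1ℤ (+ m - + 0)) ⟩
  0ℤ - gbinom -1ℤ (+ m - + 0)
    ≡⟨ sym (x≡y+z⇒y≡x-z (gbinom-pascal -1ℤ (+ m - + 0))) ⟩
  gbinom -1ℤ (+ suc m - + 0) ∎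
  where
  open ≡-Reasoning
  p = PZZ.evalAt1 (pow2 xMinus1 m)
  -1*x≡0-x : ∀ x → -1ℤ * x ≡ 0ℤ - x
  -1*x≡0-x = solve-∀
coeff-xMinus1^ (suc m) (suc k) = begin
  coeff (suc k) (PZZ.evalAt1 (pow2 xMinus1 (suc m)))
    ≡⟨ evalAt1-mul xMinus1 (pow2 xMinus1 m) (suc k) ⟩
  coeff (suc k) (mul (-1ℤ ∷ 1ℤ ∷ []) p)
    ≡⟨ trans (coeff-mul-∷ (suc k) -1ℤ (1ℤ ∷ []) p) (cong (_+_ (-1ℤ * coeff (suc k) p)) (coeff-mul-const k 1ℤ p)) ⟩
  -1ℤ * coeff (suc k) p + 1ℤ * coeff k p
    ≡⟨ cong₂ (λ g h → -1ℤ * g + 1ℤ * h) (coeff-xMinus1^ m (suc k)) (coeff-xMinus1^ m k) ⟩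
  -1ℤ * gbinom -[1+ suc k ] b + 1ℤ * gbinom -[1+ k ] (+ m - + k)
    ≡⟨ -g+h≡h-g (gbinom -[1+ suc k ] b) _ ⟩
  gbinom -[1+ k ] (+ m - + k) - gbinom -[1+ suc k ] b
    ≡⟨ sym (x≡y+z⇒y≡x-z pascal) ⟩
  gbinom -[1+ suc k ] (+ m - + k)
    ≡⟨ cong (gbinom -[1+ suc k ]) (sym (suc-x-suc-y (+ m) (+ k))) ⟩
  gbinom -[1+ suc k ] (+ suc m - + suc k) ∎
  where
  open ≡-Reasoning
  p = PZZ.evalAt1 (pow2 xMinus1 m)
  b = + m - + suc k
  -g+h≡h-g : ∀ g h → -1ℤ * g + 1ℤ * h ≡ h - g
  -g+h≡h-g = solve-∀
  suc-[x-suc-y] : ∀ x y → 1ℤ + (x - (1ℤ + y)) ≡ x - y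
  suc-[x-suc-y] = solve-∀
  suc-x-suc-y : ∀ x y → (1ℤ + x) - (1ℤ + y) ≡ x - y
  suc-x-suc-y = solve-∀
  pascal : gbinom -[1+ k ] (+ m - + k) ≡ gbinom -[1+ suc k ] (+ m - + k) + gbinom -[1+ suc k ] b
  pascal = subst (λ c → gbinom -[1+ k ] c ≡ gbinom -[1+ suc k ] c + gbinom -[1+ suc k ] b)
                 (suc-[x-suc-y] (+ m) (+ k)) (gbinom-pascal -[1+ suc k ] b)

coeffℤ-[] : ∀ i → coeffℤ i [] ≡ 0ℤ
coeffℤ-[] (+ _)    = refl
coeffℤ-[] -[1+ _ ] = refl

coeffℤ-add : ∀ i p q → coeffℤ i (add p q) ≡ coeffℤ i p + coeffℤ i q
coeffℤ-add (+ k)    p q = coeff-add k p q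
coeffℤ-add -[1+ _ ] p q = refl

coeffℤ-evalAt1-∑ : ∀ {X : Set} (t : X → Poly2) (L : List X) i →
  coeffℤ i (PZZ.evalAt1 (foldr PZZ.add [] (map t L))) ≡ ∑ L (λ x → coeffℤ i (PZZ.evalAt1 (t x)))
coeffℤ-evalAt1-∑ t []      i = coeffℤ-[] i
coeffℤ-evalAt1-∑ t (x ∷ L) i = begin
  coeffℤ i (PZZ.evalAt1 (PZZ.add (t x) (foldr PZZ.add [] (map t L))))
    ≡⟨ coeffℤ-cong (evalAt1-add (t x) _) i ⟩
  coeffℤ i (add (PZZ.evalAt1 (t x)) (PZZ.evalAt1 (foldr PZZ.add [] (map t L))))
    ≡⟨ coeffℤ-add i (PZZ.evalAt1 (t x)) _ ⟩
  coeffℤ i (PZZ.evalAt1 (t x)) + coeffℤ i (PZZ.evalAt1 (foldr PZZ.add [] (map t L)))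
    ≡⟨ cong (_+_ (coeffℤ i (PZZ.evalAt1 (t x)))) (coeffℤ-evalAt1-∑ t L i) ⟩
  coeffℤ i (PZZ.evalAt1 (t x)) + ∑ L (λ x → coeffℤ i (PZZ.evalAt1 (t x))) ∎
  where open ≡-Reasoning

coeffℤ-xMinus1^ : ∀ m i → coeffℤ i (PZZ.evalAt1 (pow2 xMinus1 m)) ≡ gbinom (-1ℤ - i) (+ m - i)
coeffℤ-xMinus1^ m (+ zero)  = coeff-xMinus1^ m 0
coeffℤ-xMinus1^ m (+ suc k) = coeff-xMinus1^ m (suc k)
coeffℤ-xMinus1^ m -[1+ s ]  = cong +_ (sym (k>n⇒nCk≡0 (ℕₚ.m≤n+m (suc s) m)))

coeffℤ-xMinus1^-yMinus1^0 : ∀ a i →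
  coeffℤ i (PZZ.evalAt1 (PZZ.mul (pow2 xMinus1 a) (pow2 yMinus1 0))) ≡ gbinom (-1ℤ - i) (+ a - i)
coeffℤ-xMinus1^-yMinus1^0 a i =
  trans (coeffℤ-cong (λ k → trans (evalAt1-mul (pow2 xMinus1 a) (pow2 yMinus1 0) k)
                                 (mul-identityʳ (PZZ.evalAt1 (pow2 xMinus1 a)) k)) i)
        (coeffℤ-xMinus1^ a i)

coeffℤ-xMinus1^-yMinus1^suc : ∀ a b i →
  coeffℤ i (PZZ.evalAt1 (PZZ.mul (pow2 xMinus1 a) (pow2 yMinus1 (suc b)))) ≡ 0ℤ
coeffℤ-xMinus1^-yMinus1^suc a b i =
  trans (coeffℤ-cong (λ k → trans (evalAt1-mul (pow2 xMinus1 a) (pow2 yMinus1 (suc b)) k)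
                                 (mul-zeroʳ (PZZ.evalAt1 (pow2 xMinus1 a)) evalAt1-yMinus1^suc k)) i)
        (coeffℤ-[] i)
  where
  evalAt1-yMinus1^suc : PZZ.evalAt1 (pow2 yMinus1 (suc b)) ≈ []
  evalAt1-yMinus1^suc k =
    trans (evalAt1-mul yMinus1 (pow2 yMinus1 b) k)
          (trans (coeff-mul-const k 0ℤ (PZZ.evalAt1 (pow2 yMinus1 b))) (ℤₚ.*-zeroˡ (coeff k (PZZ.evalAt1 (pow2 yMinus1 b)))))

ifZero : ℕ → ℤ → ℤ
ifZero zero    x = x
ifZero (suc _) x = 0ℤ

ifZero-0 : ∀ m → ifZero m 0ℤ ≡ 0ℤ
ifZero-0 zero    = refl
ifZero-0 (suc _) = refl

module _ {n : ℕ} (M : Matroid n) {d : ℕ} (d-is-d₂ : IsDk M 2 d)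
         (P? : Decidable (λ C → IsCircuit M C × ∣ C ∣ ℕ.< d)) where

  open Matroid M
  open MatroidProperties M

  ∑-circuits-⊆-independent : ∀ {A} x → Independent A →
    ∑ (filter P? (allSubsets n)) (λ C → if does (C ⊆? A) then x else 0ℤ) ≡ 0ℤ
  ∑-circuits-⊆-independent {A} x ind = trans (∑-filter P? (allSubsets n) _) (∑-zero (allSubsets n) no-circuit)
    where
    no-circuit : ∀ C → (if does (P? C) then (if does (C ⊆? A) then x else 0ℤ) else 0ℤ) ≡ 0ℤ
    no-circuit C with P? C
    ... | no _ = refl
    ... | yes (circ , _) with C ⊆? A
    ...   | no _    = refl
    ...   | yes C⊆A = contradiction (independent-⊆ C⊆A ind) (circuit-dependent circ)

  ∑-circuits-⊆-dependent : ∀ {A} x → ¬ Independent A → ∣ A ∣ ℕ.< d →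
    ∑ (filter P? (allSubsets n)) (λ C → if does (C ⊆? A) then x else 0ℤ) ≡ x
  ∑-circuits-⊆-dependent {A} x dep ∣A∣<d with C₀ , circ₀ , C₀⊆A ← dependent⇒circuit-⊆ A dep =
    trans (∑-filter P? (allSubsets n) _) (trans (∑-allSubsets-single _ C₀ others) at-C₀)
    where
    at-C₀ : (if does (P? C₀) then (if does (C₀ ⊆? A) then x else 0ℤ) else 0ℤ) ≡ x
    at-C₀ with P? C₀ | C₀ ⊆? A
    ... | yes _ | yes _    = refl
    ... | yes _ | no C₀⊈A = ⊥-elim (C₀⊈A C₀⊆A)
    ... | no ¬P | _       = contradiction (circ₀ , ℕₚ.≤-<-trans (p⊆q⇒∣p∣≤∣q∣ C₀⊆A) ∣A∣<d) ¬P
    others : ∀ C → C ≢ C₀ → (if does (P? C) then (if does (C ⊆? A) then x else 0ℤ) else 0ℤ) ≡ 0ℤ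
    others C C≢C₀ with P? C
    ... | no _ = refl
    ... | yes (circ , _) with C ⊆? A
    ...   | no _    = refl
    ...   | yes C⊆A = contradiction (distinct-circuits⇒d≤∣∪∣ d-is-d₂ circ circ₀ C≢C₀)
                        (ℕₚ.<⇒≱ (ℕₚ.≤-<-trans (p⊆q⇒∣p∣≤∣q∣ (p⊆r∧q⊆r⇒p∪q⊆r C⊆A C₀⊆A)) ∣A∣<d))

  ∑-independent-by-circuits : ∀ (h : ℕ → ℤ) → (∀ j → d ≤ j → h j ≡ 0ℤ) →
    ∑ (allSubsets n) (λ A → ifZero (∣ A ∣ ∸ rk A) (h ∣ A ∣))
      ≡ ∑ (allSubsets n) (h ∘ ∣_∣)
        - ∑ (filter P? (allSubsets n)) (λ C → ∑ (allSubsets n) (λ A → if does (C ⊆? A) then h ∣ A ∣ else 0ℤ))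
  ∑-independent-by-circuits h h-vanishes = begin
    ∑ S (λ A → ifZero (∣ A ∣ ∸ rk A) (h ∣ A ∣))
      ≡⟨ ∑-cong S pointwise ⟩
    ∑ S (λ A → h ∣ A ∣ - ∑ (filter P? S) (λ C → F C A))
      ≡⟨ ∑-- S (h ∘ ∣_∣) _ ⟩
    ∑ S (h ∘ ∣_∣) - ∑ S (λ A → ∑ (filter P? S) (λ C → F C A))
      ≡⟨ cong (_-_ (∑ S (h ∘ ∣_∣))) (∑-comm S (filter P? S) (λ A C → F C A)) ⟩
    ∑ S (h ∘ ∣_∣) - ∑ (filter P? S) (λ C → ∑ S (F C)) ∎
    where
    open ≡-Reasoning
    S = allSubsets n
    F : Subset n → Subset n → ℤ
    F C A = if does (C ⊆? A) then h ∣ A ∣ else 0ℤ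
    pointwise : ∀ A → ifZero (∣ A ∣ ∸ rk A) (h ∣ A ∣) ≡ h ∣ A ∣ - ∑ (filter P? S) (λ C → F C A)
    pointwise A with d ℕ.≤? ∣ A ∣
    ... | yes d≤∣A∣ rewrite h-vanishes ∣ A ∣ d≤∣A∣ =
      trans (ifZero-0 (∣ A ∣ ∸ rk A)) (sym (cong (_-_ 0ℤ) (∑-zero (filter P? S) (λ C → if-eta (does (C ⊆? A))))))
    ... | no d≰∣A∣ with ∣ A ∣ ∸ rk A in nullity
    ...   | zero rewrite ∑-circuits-⊆-independent (h ∣ A ∣) (ℕₚ.m∸n≡0⇒m≤n nullity) =
      sym (ℤₚ.+-identityʳ (h ∣ A ∣))
    ...   | suc _ rewrite ∑-circuits-⊆-dependent (h ∣ A ∣)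
                            (λ ind → ℕₚ.1+n≢0 (trans (sym nullity) (ℕₚ.m≤n⇒m∸n≡0 ind))) (ℕₚ.≰⇒> d≰∣A∣) =
      sym (ℤₚ.+-inverseʳ (h ∣ A ∣))

+[m∸n]≡+m-+n : ∀ {m n} → n ≤ m → + (m ∸ n) ≡ + m - + n
+[m∸n]≡+m-+n {m} {n} n≤m = trans (sym (ℤₚ.⊖-≥ n≤m)) (sym (ℤₚ.m-n≡m⊖n m n))

coeffℤ-tutteY1 : ∀ {n} (M : Matroid n) i → coeffℤ i (tutteY1 M)
  ≡ ∑ (allSubsets n) (λ A → ifZero (∣ A ∣ ∸ Matroid.rk M A) (gbinom (-1ℤ - i) (+ rank M - i - + ∣ A ∣)))
coeffℤ-tutteY1 {n} M i = trans (coeffℤ-evalAt1-∑ _ (allSubsets n) i) (∑-cong (allSubsets n) term)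
  where
  open Matroid M
  open MatroidProperties M
  term : ∀ A → coeffℤ i (PZZ.evalAt1 (PZZ.mul (pow2 xMinus1 (rank M ∸ rk A)) (pow2 yMinus1 (∣ A ∣ ∸ rk A))))
             ≡ ifZero (∣ A ∣ ∸ rk A) (gbinom (-1ℤ - i) (+ rank M - i - + ∣ A ∣))
  term A with ∣ A ∣ ∸ rk A in nullity
  ... | suc b = coeffℤ-xMinus1^-yMinus1^suc (rank M ∸ rk A) b i
  ... | zero  = begin
    coeffℤ i (PZZ.evalAt1 (PZZ.mul (pow2 xMinus1 (rank M ∸ rk A)) (pow2 yMinus1 0)))
      ≡⟨ coeffℤ-xMinus1^-yMinus1^0 (rank M ∸ rk A) i ⟩
    gbinom (-1ℤ - i) (+ (rank M ∸ rk A) - i)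
      ≡⟨ cong (λ x → gbinom (-1ℤ - i) (x - i)) (+[m∸n]≡+m-+n (rk≤rank A)) ⟩
    gbinom (-1ℤ - i) (+ rank M - + rk A - i)
      ≡⟨ cong (gbinom (-1ℤ - i)) (swap (+ rank M) (+ rk A) i) ⟩
    gbinom (-1ℤ - i) (+ rank M - i - + rk A)
      ≡⟨ cong (λ a → gbinom (-1ℤ - i) (+ rank M - i - + a)) rkA≡∣A∣ ⟩
    gbinom (-1ℤ - i) (+ rank M - i - + ∣ A ∣) ∎
    where
    open ≡-Reasoning
    swap : ∀ x a i → x - a - i ≡ x - i - a
    swap = solve-∀
    rkA≡∣A∣ : rk A ≡ ∣ A ∣
    rkA≡∣A∣ = ℕₚ.≤-antisym (rk-bound A) (ℕₚ.m∸n≡0⇒m≤n nullity)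

gbinom-vanishes : ∀ a r i d → + r - + d < i → ∀ j → d ≤ j → gbinom a (+ r - i - + j) ≡ 0ℤ
gbinom-vanishes a r i d r-d<i j d≤j = gbinom-negative a (subst (ℤ._< 0ℤ) (sym (split (+ r) i (+ d) (+ j)))
  (ℤₚ.+-mono-<-≤ r-d-i<0 (ℤₚ.i≤j⇒i-j≤0 (ℤ.+≤+ d≤j))))
  where
  r-d-i<0 : + r - + d - i < 0ℤ
  r-d-i<0 = subst (+ r - + d - i <_) (ℤₚ.+-inverseʳ i) (ℤₚ.+-monoˡ-< (- i) r-d<i)
  split : ∀ r i d j → r - i - j ≡ (r - d - i) + (d - j)
  split = solve-∀

∑-gbinom-card : ∀ n r i → r ℕ.< n →
  ∑ (allSubsets n) (λ A → gbinom (-1ℤ - i) (+ r - i - + ∣ A ∣)) ≡ binomℤ (+ n - i - + 1) (+ r - i)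
∑-gbinom-card n r i r<n = begin
  ∑ (allSubsets n) (λ A → gbinom (-1ℤ - i) (+ r - i - + ∣ A ∣))
    ≡⟨ ∑-allSubsets-card n (λ j → gbinom (-1ℤ - i) (+ r - i - + j)) ⟩
  binomialSum n (λ j → gbinom (-1ℤ - i) (+ r - i - + j))
    ≡⟨ gbinom-vandermonde n (-1ℤ - i) (+ r - i) ⟩
  gbinom (-1ℤ - i + + n) (+ r - i)
    ≡⟨ cong (λ a → gbinom a (+ r - i)) (reorder (+ n) i) ⟩
  gbinom (+ n - i - + 1) (+ r - i)
    ≡⟨ gbinom≡binomℤ _ _ (n ∸ suc r) upper≡lower+[n∸1+r] ⟩
  binomℤ (+ n - i - + 1) (+ r - i) ∎
  where
  open ≡-Reasoning
  reorder : ∀ n i → -1ℤ - i + n ≡ n - i - 1ℤ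
  reorder = solve-∀
  split : ∀ n r i → n - i - 1ℤ ≡ (r - i) + (n - (1ℤ + r))
  split = solve-∀
  upper≡lower+[n∸1+r] : + n - i - + 1 ≡ (+ r - i) + + (n ∸ suc r)
  upper≡lower+[n∸1+r] = trans (split (+ n) (+ r) i) (cong (_+_ (+ r - i)) (sym (+[m∸n]≡+m-+n r<n)))

∑-gbinom-supersets : ∀ {n} r i (C : Subset n) → r ℕ.< n →
  ∑ (allSubsets n) (λ A → if does (C ⊆? A) then gbinom (-1ℤ - i) (+ r - i - + ∣ A ∣) else 0ℤ)
    ≡ binomℤ (+ n - + ∣ C ∣ - i - + 1) (+ n - + r - + 1)
∑-gbinom-supersets {n} r i C r<n = begin
  ∑ (allSubsets n) (λ A → if does (C ⊆? A) then gbinom (-1ℤ - i) (+ r - i - + ∣ A ∣) else 0ℤ)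
    ≡⟨ ∑-supersets-card C (λ j → gbinom (-1ℤ - i) (+ r - i - + j)) ⟩
  binomialSum (n ∸ c) (λ j → gbinom (-1ℤ - i) (+ r - i - + (c ℕ.+ j)))
    ≡⟨ binomialSum-cong (n ∸ c) (λ j → cong (gbinom (-1ℤ - i)) (shift (+ r) i (+ c) (+ j))) ⟩
  binomialSum (n ∸ c) (λ j → gbinom (-1ℤ - i) (+ r - i - + c - + j))
    ≡⟨ gbinom-vandermonde (n ∸ c) (-1ℤ - i) (+ r - i - + c) ⟩
  gbinom (-1ℤ - i + + (n ∸ c)) (+ r - i - + c)
    ≡⟨ cong (λ a → gbinom a (+ r - i - + c))
            (trans (cong (_+_ (-1ℤ - i)) (+[m∸n]≡+m-+n (∣p∣≤n C))) (reorder (+ n) (+ c) i)) ⟩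
  gbinom (+ n - + c - i - + 1) (+ r - i - + c)
    ≡⟨ gbinom≡binomℤ _ _ (n ∸ suc r) upper≡lower+[n∸1+r] ⟩
  binomℤ (+ n - + c - i - + 1) (+ r - i - + c)
    ≡⟨ binomℤ-sym _ _ (n ∸ suc r) upper≡lower+[n∸1+r] ⟩
  binomℤ (+ n - + c - i - + 1) (+ (n ∸ suc r))
    ≡⟨ cong (binomℤ (+ n - + c - i - + 1)) (trans (+[m∸n]≡+m-+n r<n) (minus-suc (+ n) (+ r))) ⟩
  binomℤ (+ n - + c - i - + 1) (+ n - + r - + 1) ∎
  where
  open ≡-Reasoning
  c = ∣ C ∣
  shift : ∀ r i c j → r - i - (c + j) ≡ r - i - c - j
  shift = solve-∀
  reorder : ∀ n c i → -1ℤ - i + (n - c) ≡ n - c - i - 1ℤ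
  reorder = solve-∀
  minus-suc : ∀ n r → n - (1ℤ + r) ≡ n - r - 1ℤ
  minus-suc = solve-∀
  split : ∀ n c i r → n - c - i - 1ℤ ≡ (r - i - c) + (n - (1ℤ + r))
  split = solve-∀
  upper≡lower+[n∸1+r] : + n - + c - i - + 1 ≡ (+ r - i - + c) + + (n ∸ suc r)
  upper≡lower+[n∸1+r] = trans (split (+ n) (+ c) i (+ r)) (cong (_+_ (+ r - i - + c)) (sym (+[m∸n]≡+m-+n r<n)))

theorem3p4 : {n : ℕ} (M : Matroid n) (d₂ : ℕ) → IsDk M 2 d₂ →
    (i : ℤ) → (+ rank M) - (+ d₂) < i →
    coeffℤ i (tutteY1 M)
      ≡ binomℤ (+ n - i - + 1) (+ rank M - i)
        - sumCircuitsBelow M d₂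
            (λ C → binomℤ (+ n - + ∣ C ∣ - i - + 1) (+ n - + rank M - + 1))
theorem3p4 {n} M d₂ d-is-d₂ i r-d₂<i = begin
  coeffℤ i (tutteY1 M)
    ≡⟨ coeffℤ-tutteY1 M i ⟩
  ∑ S (λ A → ifZero (∣ A ∣ ∸ Matroid.rk M A) (h ∣ A ∣))
    ≡⟨ ∑-independent-by-circuits M d-is-d₂ _ h (gbinom-vanishes (-1ℤ - i) r i d₂ r-d₂<i) ⟩
  ∑ S (h ∘ ∣_∣) - sumCircuitsBelow M d₂ supersets
    ≡⟨ cong₂ _-_ (∑-gbinom-card n r i r<n) (∑-cong (filter _ S) (λ C → ∑-gbinom-supersets r i C r<n)) ⟩
  binomℤ (+ n - i - + 1) (+ r - i) - sumCircuitsBelow M d₂ circuitTerm ∎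
  where
  open ≡-Reasoning
  S = allSubsets n
  r = rank M
  h : ℕ → ℤ
  h j = gbinom (-1ℤ - i) (+ r - i - + j)
  supersets circuitTerm : Subset n → ℤ
  supersets C = ∑ S (λ A → if does (C ⊆? A) then h ∣ A ∣ else 0ℤ)
  circuitTerm C = binomℤ (+ n - + ∣ C ∣ - i - + 1) (+ n - + r - + 1)
  r<n : r ℕ.< n
  r<n = ℕₚ.<⇒≤ (MatroidProperties.2+rank≤n M d-is-d₂)
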